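{- Let $s=(s_1,\dots,s_n)$ be a composition and $\mathbf d=(0,0,s_n,s_{n-1},\dots,s_2,-\sum_{i=2}^ns_i)$. The set of Stirling $s$-permutations is in bijection with the set of integer $\mathbf d$-flows of $G_s$.
   Context: A Stirling $s$-permutation is a word in which each $i\in[n]$ occurs $s_i$ times and which avoids the pattern $121$ (no $i<j$ with an occurrence of $j$ between two occurrences of $i$). Graph $G_s$ ($s_{n+1}:=2$): vertices $v_{ -1},v_0,\dots,v_n$; for $i\in[1,n+1]$, $s_i-1$ edges from $v_{ -1}$ to $v_{n+1-i}$; for $i\in[1,n]$, two edges from $v_{n-i}$ to $v_{n+1-i}$. The entries of $\mathbf d$ are indexed by $v_{ -1},v_0,v_1,\dots,v_n$ in this order. An integer $\mathbf d$-flow is $f\in\mathbb Z_{\ge0}^E$ such that at every vertex $v$, (sum of $f$ on incoming edges) $+\ \mathbf d_v=$ (sum of $f$ on outgoing edges). -}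

module Defs where

open import Data.Nat as ℕ using (ℕ; zero; suc; _+_; _∸_; _≡ᵇ_; _≤ᵇ_)
open import Data.Fin as Fin using (Fin; toℕ; _≟_)
open import Data.List using (List; []; _∷_; length; lookup; map; concatMap; replicate; upTo; _++_; filter)
open import Data.Vec as Vec using (Vec; toList)
open import Data.Nat.ListAction using (sum)
open import Data.Integer as ℤ using (ℤ; +_; -_)
open import Data.Product using (Σ; _×_; _,_; proj₁; proj₂)
open import Data.Bool using (if_then_else_)
open import Relation.Binary.Bundles using (Setoid)
open import Relation.Binary.PropositionalEquality using (_≡_; setoid)
import Relation.Binary.Construct.On as On
open import Relation.Nullary using (¬_)

-- A composition s = (s_1,…,s_n) is given as s : Fin n → ℕ, s_i = s (i-1),
-- with every part positive.
IsComposition : {n : ℕ} → (Fin n → ℕ) → Set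
IsComposition s = ∀ i → 1 ℕ.≤ s i

HasMultiplicities : {n : ℕ} → (Fin n → ℕ) → List (Fin n) → Set
HasMultiplicities s w = ∀ i → length (filter (_≟ i) w) ≡ s i

Avoids121 : {n : ℕ} → List (Fin n) → Set
Avoids121 w = ∀ (a b c : Fin (length w)) → a Fin.< b → b Fin.< c →
  lookup w a ≡ lookup w c → ¬ (lookup w a Fin.< lookup w b)

IsStirlingPerm : {n : ℕ} → (Fin n → ℕ) → List (Fin n) → Set
IsStirlingPerm s w = HasMultiplicities s w × Avoids121 w

StirlingPerm : {n : ℕ} → (Fin n → ℕ) → Set
StirlingPerm s = Σ (List (Fin _)) (IsStirlingPerm s)

StirlingPermSetoid : {n : ℕ} → (Fin n → ℕ) → Setoid _ _
StirlingPermSetoid {n} s = On.setoid {B = StirlingPerm s} (setoid (List (Fin n))) proj₁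

-- 1-based access s_i for i ∈ [1,n], with the convention s_{n+1} := 2
-- (value 0 outside [1,n+1], never used)
sAt : {n : ℕ} → (Fin n → ℕ) → ℕ → ℕ
sAt {n} s i = if i ≡ᵇ suc n then 2 else go n s i
  where
  go : (m : ℕ) → (Fin m → ℕ) → ℕ → ℕ
  go zero    t _             = 0
  go (suc m) t zero          = 0
  go (suc m) t (suc zero)    = t Fin.zero
  go (suc m) t (suc (suc k)) = go m (λ j → t (Fin.suc j)) (suc k)

-- Vertex codes: v_{-1} ↦ 0, v_k ↦ k + 1 (k = 0,…,n). There are n+2 vertices.
vtx : ℕ → ℕ
vtx k = suc k

vminus1 : ℕ
vminus1 = 0

Edge : Set
Edge = ℕ × ℕ     -- (source , target)

edges : {n : ℕ} → (Fin n → ℕ) → List Edge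
edges {n} s =
  concatMap (λ i → replicate (sAt s i ∸ 1) (vminus1 , vtx (n + 1 ∸ i))) (map suc (upTo (n + 1)))
  ++
  concatMap (λ i → replicate 2 (vtx (n ∸ i) , vtx (n + 1 ∸ i))) (map suc (upTo n))

numEdges : {n : ℕ} → (Fin n → ℕ) → ℕ
numEdges s = length (edges s)

-- the vector d, indexed by vertex code:
-- d = (0, 0, s_n, s_{n-1}, …, s_2, -(s_2+…+s_n)), for n ≥ 1
dvec : {n : ℕ} → (Fin n → ℕ) → ℕ → ℤ
dvec {n} s c =
  if c ≡ᵇ suc n then - (+ sum (map (λ i → sAt s (i + 2)) (upTo (n ∸ 1))))
  else if c ≤ᵇ 1 then + 0
  else + sAt s (n + 2 ∸ c)

inflow : List Edge → List ℕ → ℕ → ℕ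
inflow ((_ , t) ∷ es) (x ∷ xs) v = (if t ≡ᵇ v then x else 0) + inflow es xs v
inflow _ _ _ = 0

outflow : List Edge → List ℕ → ℕ → ℕ
outflow ((o , _) ∷ es) (x ∷ xs) v = (if o ≡ᵇ v then x else 0) + outflow es xs v
outflow _ _ _ = 0

-- integer d-flow: f ∈ ℤ_{≥0}^E (one entry per edge, in the order of `edges s`)
-- with  inflow(v) + d_v = outflow(v)  at every vertex v
IsDFlow : {n : ℕ} → (s : Fin n → ℕ) → Vec ℕ (numEdges s) → Set
IsDFlow {n} s f = ∀ (v : Fin (n + 2)) →
  (+ inflow (edges s) (toList f) (toℕ v)) ℤ.+ dvec s (toℕ v)
    ≡ + outflow (edges s) (toList f) (toℕ v)

DFlow : {n : ℕ} → (Fin n → ℕ) → Set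
DFlow s = Σ (Vec ℕ (numEdges s)) (IsDFlow s)

DFlowSetoid : {n : ℕ} → (Fin n → ℕ) → Setoid _ _
DFlowSetoid s = On.setoid {B = DFlow s} (setoid (Vec ℕ (numEdges s))) proj₁

-- In a 121-avoiding word the occurrences of the least letter 1 form a single block, since a
-- larger letter between two 1s would be the 2 of a 121. Deleting the block and lowering the
-- other letters leaves a Stirling permutation for (s_2,…,s_n); the word is recovered from it
-- together with the numbers a and b of letters before and after the block, where
-- a + b = s_2 + ⋯ + s_n, and since s_1 ≥ 1 every such pair occurs. Iterating, Stirling
-- s-permutations correspond to sequences of pairs (a_i, b_i) with a_i + b_i = s_{i+1} + ⋯ + s_n.
-- On the flow side, v_{-1} has no incoming edges and d vanishes there, so every edge leaving it
-- carries 0. Conservation along v_0 ⇉ v_1 ⇉ ⋯ ⇉ v_n then says exactly that the two parallel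
-- edges v_{n-i} ⇉ v_{n+1-i} carry flows with sum s_{i+1} + ⋯ + s_n, and these two flows are the
-- pair (a_i, b_i).
module Submission where

open import Defs

open import Data.Bool using (true; false; if_then_else_)
open import Data.Bool.Properties using (if-eta)
open import Data.Empty using (⊥-elim)
open import Data.Fin as Fin using (Fin; toℕ; _≟_; fromℕ<)
open import Data.Fin.Properties using (toℕ-fromℕ<; toℕ<n)
open import Data.Integer as ℤ using (+_; -_)
import Data.Integer.Properties as ℤ
open import Data.List
  using (List; []; _∷_; length; lookup; map; replicate; _++_; filter; upTo; applyUpTo; concat; concatMap; drop; take)
open import Data.List.Properties using (map-applyUpTo; length-++; length-replicate; length-drop; take++drop≡id)
open import Data.List.Relation.Binary.Sublist.Propositional using (_⊆_; []; _∷_; _∷ʳ_)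
open import Data.List.Relation.Binary.Sublist.Propositional.Properties using ([]⊆-universal; ∷ˡ⁻)
open import Data.List.Relation.Unary.All using (All; []; _∷_)
open import Data.List.Relation.Unary.All.Properties using (++⁺; replicate⁺)
open import Data.Nat as ℕ using (ℕ; zero; suc; _+_; _∸_; z≤n; s≤s; _≤_; _<_; _≡ᵇ_)
open import Data.Nat.ListAction using (sum)
open import Data.Nat.Properties hiding (_≟_)
open import Data.Nat.Tactic.RingSolver using (solve-∀)
open import Algebra.Properties.Monoid.Sum +-0-monoid using (sum-cong-≗) renaming (sum to ∑)
open import Data.Product as Product using (Σ; Σ-syntax; ∃; ∃₂; _×_; _,_; proj₁)
open import Data.Sum using (inj₁; inj₂)
open import Data.Vec as Vec using (Vec; toList)
open import Data.Vec.Functional using (tail)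
open import Data.Vec.Properties using (toList-injective; length-toList)
open import Data.Vec.Relation.Binary.Equality.Cast using (cast-is-id)
open import Function.Base using (_∘_; id)
open import Function.Bundles using (Bijection; Inverse; _⇔_; mk⇔; Equivalence)
import Function.Construct.Composition as Compose
open import Function.Properties.Inverse using (Inverse⇒Bijection)
open import Relation.Binary.Bundles using (Setoid)
import Relation.Binary.Construct.On as On
open import Relation.Binary.PropositionalEquality
  using (_≡_; refl; sym; trans; cong; cong₂; subst; setoid; module ≡-Reasoning)
open import Relation.Nullary using (¬_; does)
open import Relation.Nullary.Decidable using (dec-true; dec-false)

open ≡-Reasoning

private variable
  A : Set
  m n : ℕ

inverse-restrict : {B : Set} {P : A → Set} {Q : B → Set} (f : A → B) (g : B → A) →
  (∀ {a} → P a → Q (f a)) → (∀ {b} → Q b → P (g b)) →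
  (∀ {a} → P a → g (f a) ≡ a) → (∀ {b} → Q b → f (g b) ≡ b) →
  Inverse (On.setoid {B = Σ A P} (setoid A) proj₁) (On.setoid {B = Σ B Q} (setoid B) proj₁)
inverse-restrict f g f-pres g-pres g∘f f∘g = record
  { to        = Product.map f f-pres
  ; from      = Product.map g g-pres
  ; to-cong   = cong f
  ; from-cong = cong g
  ; inverse   = (λ { {b , q} refl → f∘g q }) , (λ { {a , p} refl → g∘f p })
  }

-- 121-patterns as sublists

Has121 : List (Fin n) → Set
Has121 w = ∃₂ λ i j → i Fin.< j × (i ∷ j ∷ i ∷ []) ⊆ w

has121-∷ : {x : Fin n} {w : List (Fin n)} → Has121 w → Has121 (x ∷ w)
has121-∷ {x = x} (i , j , i<j , σ) = i , j , i<j , x ∷ʳ σ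

lookup-⊆₁ : {x : A} {w : List A} → (x ∷ []) ⊆ w → Σ[ c ∈ Fin (length w) ] lookup w c ≡ x
lookup-⊆₁ (_ ∷ʳ σ)   = Product.map Fin.suc id (lookup-⊆₁ σ)
lookup-⊆₁ (refl ∷ _) = Fin.zero , refl

lookup-⊆₂ : {x y : A} {w : List A} → (x ∷ y ∷ []) ⊆ w →
  Σ[ b ∈ Fin (length w) ] Σ[ c ∈ Fin (length w) ] b Fin.< c × lookup w b ≡ x × lookup w c ≡ y
lookup-⊆₂ (_ ∷ʳ σ) with lookup-⊆₂ σ
... | b , c , b<c , eb , ec = Fin.suc b , Fin.suc c , s≤s b<c , eb , ec
lookup-⊆₂ (refl ∷ σ) with lookup-⊆₁ σ
... | c , ec = Fin.zero , Fin.suc c , s≤s z≤n , refl , ec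

lookup-⊆₃ : {x y z : A} {w : List A} → (x ∷ y ∷ z ∷ []) ⊆ w →
  Σ[ a ∈ Fin (length w) ] Σ[ b ∈ Fin (length w) ] Σ[ c ∈ Fin (length w) ]
  a Fin.< b × b Fin.< c × lookup w a ≡ x × lookup w b ≡ y × lookup w c ≡ z
lookup-⊆₃ (_ ∷ʳ σ) with lookup-⊆₃ σ
... | a , b , c , a<b , b<c , ea , eb , ec = Fin.suc a , Fin.suc b , Fin.suc c , s≤s a<b , s≤s b<c , ea , eb , ec
lookup-⊆₃ (refl ∷ σ) with lookup-⊆₂ σ
... | b , c , b<c , eb , ec = Fin.zero , Fin.suc b , Fin.suc c , s≤s z≤n , s≤s b<c , refl , eb , ec

⊆-lookup₁ : (w : List A) (c : Fin (length w)) → (lookup w c ∷ []) ⊆ w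
⊆-lookup₁ (x ∷ w) Fin.zero    = refl ∷ []⊆-universal w
⊆-lookup₁ (x ∷ w) (Fin.suc c) = x ∷ʳ ⊆-lookup₁ w c

⊆-lookup₂ : (w : List A) (b c : Fin (length w)) → b Fin.< c → (lookup w b ∷ lookup w c ∷ []) ⊆ w
⊆-lookup₂ (x ∷ w) Fin.zero    (Fin.suc c) _         = refl ∷ ⊆-lookup₁ w c
⊆-lookup₂ (x ∷ w) (Fin.suc b) (Fin.suc c) (s≤s b<c) = x ∷ʳ ⊆-lookup₂ w b c b<c

⊆-lookup₃ : (w : List A) (a b c : Fin (length w)) → a Fin.< b → b Fin.< c →
  (lookup w a ∷ lookup w b ∷ lookup w c ∷ []) ⊆ w
⊆-lookup₃ (x ∷ w) Fin.zero    (Fin.suc b) (Fin.suc c) _         (s≤s b<c) = refl ∷ ⊆-lookup₂ w b c b<c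
⊆-lookup₃ (x ∷ w) (Fin.suc a) (Fin.suc b) (Fin.suc c) (s≤s a<b) (s≤s b<c) = x ∷ʳ ⊆-lookup₃ w a b c a<b b<c

avoids121⇒¬has121 : {w : List (Fin n)} → Avoids121 w → ¬ Has121 w
avoids121⇒¬has121 avoids (i , j , i<j , σ) with lookup-⊆₃ σ
... | a , b , c , a<b , b<c , refl , refl , ec = avoids a b c a<b b<c (sym ec) i<j

¬has121⇒avoids121 : {w : List (Fin n)} → ¬ Has121 w → Avoids121 w
¬has121⇒avoids121 {w = w} no121 a b c a<b b<c ea≡ec ea<eb = no121 (lookup w a , lookup w b , ea<eb ,
  subst (λ z → (lookup w a ∷ lookup w b ∷ z ∷ []) ⊆ w) (sym ea≡ec) (⊆-lookup₃ w a b c a<b b<c))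

-- Removing the least letter

count : Fin n → List (Fin n) → ℕ
count i w = length (filter (_≟ i) w)

deleteLeast : List (Fin (suc n)) → List (Fin n)
deleteLeast []              = []
deleteLeast (Fin.zero ∷ w)  = deleteLeast w
deleteLeast (Fin.suc x ∷ w) = x ∷ deleteLeast w

leastPosition : List (Fin (suc n)) → ℕ
leastPosition []              = 0
leastPosition (Fin.zero ∷ _)  = 0
leastPosition (Fin.suc _ ∷ w) = suc (leastPosition w)

insertLeast : ℕ → ℕ → List (Fin n) → List (Fin (suc n))
insertLeast zero    k u       = replicate k Fin.zero ++ map Fin.suc u
insertLeast (suc p) k []      = insertLeast zero k []
insertLeast (suc p) k (x ∷ u) = Fin.suc x ∷ insertLeast p k u

count-deleteLeast : ∀ (i : Fin n) w → count (Fin.suc i) w ≡ count i (deleteLeast w)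
count-deleteLeast i []              = refl
count-deleteLeast i (Fin.zero ∷ w)  = count-deleteLeast i w
count-deleteLeast i (Fin.suc x ∷ w) with does (x ≟ i)
... | true  = cong suc (count-deleteLeast i w)
... | false = count-deleteLeast i w

length-deleteLeast : ∀ (w : List (Fin (suc n))) → length w ≡ count Fin.zero w + length (deleteLeast w)
length-deleteLeast []              = refl
length-deleteLeast (Fin.zero ∷ w)  = cong suc (length-deleteLeast w)
length-deleteLeast (Fin.suc x ∷ w) = trans (cong suc (length-deleteLeast w)) (sym (+-suc _ _))

length≡∑count : ∀ (u : List (Fin n)) → length u ≡ ∑ (λ i → count i u)
length≡∑count {zero}  []    = refl
length≡∑count {suc n} u = trans (length-deleteLeast u) (cong (λ x → count Fin.zero u + x)
  (trans (length≡∑count (deleteLeast u)) (sum-cong-≗ (λ i → sym (count-deleteLeast i u)))))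

leastPosition≤length : ∀ (w : List (Fin (suc n))) → leastPosition w ≤ length (deleteLeast w)
leastPosition≤length []              = z≤n
leastPosition≤length (Fin.zero ∷ w)  = z≤n
leastPosition≤length (Fin.suc x ∷ w) = s≤s (leastPosition≤length w)

deleteLeast-insertBlock : ∀ k (u : List (Fin n)) → deleteLeast (replicate k Fin.zero ++ map Fin.suc u) ≡ u
deleteLeast-insertBlock zero    []      = refl
deleteLeast-insertBlock zero    (x ∷ u) = cong (x ∷_) (deleteLeast-insertBlock zero u)
deleteLeast-insertBlock (suc k) u       = deleteLeast-insertBlock k u

deleteLeast-insertLeast : ∀ p k (u : List (Fin n)) → deleteLeast (insertLeast p k u) ≡ u
deleteLeast-insertLeast zero    k u       = deleteLeast-insertBlock k u
deleteLeast-insertLeast (suc p) k []      = deleteLeast-insertBlock k []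
deleteLeast-insertLeast (suc p) k (x ∷ u) = cong (x ∷_) (deleteLeast-insertLeast p k u)

count-insertBlock : ∀ k (u : List (Fin n)) → count Fin.zero (replicate k Fin.zero ++ map Fin.suc u) ≡ k
count-insertBlock zero    []      = refl
count-insertBlock zero    (x ∷ u) = count-insertBlock zero u
count-insertBlock (suc k) u       = cong suc (count-insertBlock k u)

count-insertLeast : ∀ p k (u : List (Fin n)) → count Fin.zero (insertLeast p k u) ≡ k
count-insertLeast zero    k u       = count-insertBlock k u
count-insertLeast (suc p) k []      = count-insertBlock k []
count-insertLeast (suc p) k (x ∷ u) = count-insertLeast p k u

leastPosition-insertLeast : ∀ p k (u : List (Fin n)) → 1 ≤ k → p ≤ length u →
  leastPosition (insertLeast p k u) ≡ p
leastPosition-insertLeast zero    (suc k) u       _   _         = refl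
leastPosition-insertLeast (suc p) k       (x ∷ u) k≥1 (s≤s p≤u) = cong suc (leastPosition-insertLeast p k u k≥1 p≤u)

deleteLeast-mono : {xs ys : List (Fin (suc n))} → xs ⊆ ys → deleteLeast xs ⊆ deleteLeast ys
deleteLeast-mono []                                  = []
deleteLeast-mono (Fin.zero ∷ʳ σ)                     = deleteLeast-mono σ
deleteLeast-mono (Fin.suc y ∷ʳ σ)                    = y ∷ʳ deleteLeast-mono σ
deleteLeast-mono {xs = Fin.zero ∷ _}  (refl ∷ σ)     = deleteLeast-mono σ
deleteLeast-mono {xs = Fin.suc _ ∷ _} (refl ∷ σ)     = refl ∷ deleteLeast-mono σ

map-suc-⊆ : {xs : List (Fin n)} (w : List (Fin (suc n))) → xs ⊆ deleteLeast w → map Fin.suc xs ⊆ w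
map-suc-⊆ []              []         = []
map-suc-⊆ (Fin.zero ∷ w)  σ          = Fin.zero ∷ʳ map-suc-⊆ w σ
map-suc-⊆ (Fin.suc x ∷ w) (_ ∷ʳ σ)   = Fin.suc x ∷ʳ map-suc-⊆ w σ
map-suc-⊆ (Fin.suc x ∷ w) (refl ∷ σ) = refl ∷ map-suc-⊆ w σ

zero⊈map-suc : {xs : List (Fin (suc n))} (u : List (Fin n)) → ¬ (Fin.zero ∷ xs) ⊆ map Fin.suc u
zero⊈map-suc (x ∷ u) (_ ∷ʳ σ) = zero⊈map-suc u σ

insertLeast-contiguous : ∀ {j : Fin n} p k u → ¬ (Fin.zero ∷ Fin.suc j ∷ Fin.zero ∷ []) ⊆ insertLeast p k u
insertLeast-contiguous zero    k       u       = block k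
  where
  tail-block : ∀ {j} k → ¬ (Fin.suc j ∷ Fin.zero ∷ []) ⊆ (replicate k Fin.zero ++ map Fin.suc u)
  tail-block zero    σ        = zero⊈map-suc u (∷ˡ⁻ σ)
  tail-block (suc k) (_ ∷ʳ σ) = tail-block k σ
  block : ∀ k → ¬ (Fin.zero ∷ Fin.suc _ ∷ Fin.zero ∷ []) ⊆ (replicate k Fin.zero ++ map Fin.suc u)
  block zero    σ          = zero⊈map-suc u σ
  block (suc k) (_ ∷ʳ σ)   = block k σ
  block (suc k) (refl ∷ σ) = tail-block k σ
insertLeast-contiguous (suc p) k []      = insertLeast-contiguous zero k []
insertLeast-contiguous (suc p) k (x ∷ u) (_ ∷ʳ σ) = insertLeast-contiguous p k u σ

has121-deleteLeast : {w : List (Fin (suc n))} → Has121 (deleteLeast w) → Has121 w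
has121-deleteLeast {w = w} (i , j , i<j , σ) = Fin.suc i , Fin.suc j , s≤s i<j , map-suc-⊆ w σ

has121-insertLeast : ∀ p k (u : List (Fin n)) → Has121 (insertLeast p k u) → Has121 u
has121-insertLeast p k u (Fin.zero , Fin.suc j , _ , σ) = ⊥-elim (insertLeast-contiguous p k u σ)
has121-insertLeast p k u (Fin.suc i , Fin.suc j , s≤s i<j , σ) =
  i , j , i<j , subst (_ ⊆_) (deleteLeast-insertLeast p k u) (deleteLeast-mono σ)

least-free : {r : List (Fin (suc n))} → ¬ (Fin.zero ∷ []) ⊆ r → r ≡ map Fin.suc (deleteLeast r) × count Fin.zero r ≡ 0
least-free {r = []}            _      = refl , refl
least-free {r = Fin.zero ∷ r}  noZero = ⊥-elim (noZero (refl ∷ []⊆-universal r))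
least-free {r = Fin.suc x ∷ r} noZero = Product.map₁ (cong (Fin.suc x ∷_)) (least-free (noZero ∘ (Fin.suc x ∷ʳ_)))

-- A larger letter followed by a further least letter would complete a 121.
least-block : (r : List (Fin (suc n))) → ¬ Has121 (Fin.zero ∷ r) →
  r ≡ replicate (count Fin.zero r) Fin.zero ++ map Fin.suc (deleteLeast r)
least-block []              _     = refl
least-block (Fin.zero ∷ r)  no121 = cong (Fin.zero ∷_) (least-block r (no121 ∘ has121-∷))
least-block (Fin.suc x ∷ r) no121 with least-free {r = r} (λ σ → no121 (Fin.zero , Fin.suc x , s≤s z≤n , refl ∷ refl ∷ σ))
... | r≡ , count≡0 rewrite count≡0 = cong (Fin.suc x ∷_) r≡

insertLeast-deleteLeast : (w : List (Fin (suc n))) → ¬ Has121 w →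
  insertLeast (leastPosition w) (count Fin.zero w) (deleteLeast w) ≡ w
insertLeast-deleteLeast []              _     = refl
insertLeast-deleteLeast (Fin.zero ∷ r)  no121 = cong (Fin.zero ∷_) (sym (least-block r no121))
insertLeast-deleteLeast (Fin.suc x ∷ r) no121 =
  cong (Fin.suc x ∷_) (insertLeast-deleteLeast r (no121 ∘ has121-∷))

stirling-deleteLeast : (s : Fin (suc n) → ℕ) (w : List (Fin (suc n))) →
  IsStirlingPerm s w → IsStirlingPerm (tail s) (deleteLeast w)
stirling-deleteLeast s w (mult , avoids) =
  (λ i → trans (sym (count-deleteLeast i w)) (mult (Fin.suc i))) ,
  ¬has121⇒avoids121 (avoids121⇒¬has121 {w = w} avoids ∘ has121-deleteLeast)

stirling-insertLeast : (s : Fin (suc n) → ℕ) (p : ℕ) (u : List (Fin n)) →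
  IsStirlingPerm (tail s) u → IsStirlingPerm s (insertLeast p (s Fin.zero) u)
stirling-insertLeast s p u (mult , avoids) = mult′ ,
  ¬has121⇒avoids121 (avoids121⇒¬has121 {w = u} avoids ∘ has121-insertLeast p (s Fin.zero) u)
  where
  mult′ : HasMultiplicities s (insertLeast p (s Fin.zero) u)
  mult′ Fin.zero    = count-insertLeast p (s Fin.zero) u
  mult′ (Fin.suc i) = trans (count-deleteLeast i (insertLeast p (s Fin.zero) u))
    (trans (cong (count i) (deleteLeast-insertLeast p (s Fin.zero) u)) (mult i))

length≡∑multiplicities : (s : Fin n → ℕ) (w : List (Fin n)) → HasMultiplicities s w → length w ≡ ∑ s
length≡∑multiplicities s w mult = trans (length≡∑count w) (sum-cong-≗ mult)

-- Pair codes

-- A pair code for t lists, for each letter i in turn, how many of the larger letters lie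
-- before and after the block of i's.
data PairCode : (m : ℕ) → (Fin m → ℕ) → List ℕ → Set where
  []  : {t : Fin 0 → ℕ} → PairCode 0 t []
  _∷_ : {t : Fin (suc m) → ℕ} {a b : ℕ} {ys : List ℕ} →
        a + b ≡ ∑ (tail t) → PairCode m (tail t) ys → PairCode (suc m) t (a ∷ b ∷ ys)

PairCodeSetoid : (m : ℕ) → (Fin m → ℕ) → Setoid _ _
PairCodeSetoid m t = On.setoid {B = Σ (List ℕ) (PairCode m t)} (setoid (List ℕ)) proj₁

encode : List (Fin n) → List ℕ
encode {zero}  w = []
encode {suc n} w = leastPosition w ∷ (length (deleteLeast w) ∸ leastPosition w) ∷ encode (deleteLeast w)

decode : (Fin n → ℕ) → List ℕ → List (Fin n)
decode {zero}  t _            = []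
decode {suc n} t (a ∷ _ ∷ ys) = insertLeast a (t Fin.zero) (decode (tail t) ys)
decode {suc n} t []           = []
decode {suc n} t (_ ∷ [])     = []

encode-pairCode : (s : Fin n → ℕ) (w : List (Fin n)) → IsStirlingPerm s w → PairCode n s (encode w)
encode-pairCode {zero}  s [] _ = []
encode-pairCode {suc n} s w stirling =
  trans (m+[n∸m]≡n (leastPosition≤length w)) (length≡∑multiplicities (tail s) (deleteLeast w) (proj₁ stirling′)) ∷
  encode-pairCode (tail s) (deleteLeast w) stirling′
  where
  stirling′ : IsStirlingPerm (tail s) (deleteLeast w)
  stirling′ = stirling-deleteLeast s w stirling

decode-encode : (s : Fin n → ℕ) (w : List (Fin n)) → IsStirlingPerm s w → decode s (encode w) ≡ w
decode-encode {zero}  s [] _ = refl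
decode-encode {suc n} s w stirling@(mult , avoids)
  rewrite decode-encode (tail s) (deleteLeast w) (stirling-deleteLeast s w stirling) | sym (mult Fin.zero) =
  insertLeast-deleteLeast w (avoids121⇒¬has121 avoids)

decode-stirling : (s : Fin n → ℕ) (ys : List ℕ) → PairCode n s ys → IsStirlingPerm s (decode s ys)
decode-stirling s []           []         = (λ ()) , (λ ())
decode-stirling s (a ∷ b ∷ ys) (_ ∷ code) = stirling-insertLeast s a _ (decode-stirling (tail s) ys code)

-- Recovering the position of the block needs the block to be nonempty.
encode-insertLeast : ∀ a b k (u : List (Fin n)) → 1 ≤ k → length u ≡ a + b →
  encode (insertLeast a k u) ≡ a ∷ b ∷ encode u
encode-insertLeast a b k u k≥1 length-u
  rewrite deleteLeast-insertLeast a k u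
        | leastPosition-insertLeast a k u k≥1 (subst (a ≤_) (sym length-u) (m≤m+n a b))
        | length-u | m+n∸m≡n a b = refl

encode-decode : (s : Fin n → ℕ) → IsComposition s → (ys : List ℕ) → PairCode n s ys → encode (decode s ys) ≡ ys
encode-decode s composition [] [] = refl
encode-decode s composition (a ∷ b ∷ ys) (a+b≡ ∷ code) =
  trans (encode-insertLeast a b (s Fin.zero) u (composition Fin.zero) length-u)
        (cong (λ zs → a ∷ b ∷ zs) (encode-decode (tail s) (composition ∘ Fin.suc) ys code))
  where
  u : List (Fin _)
  u = decode (tail s) ys
  length-u : length u ≡ a + b
  length-u = trans (length≡∑multiplicities (tail s) u (proj₁ (decode-stirling (tail s) ys code))) (sym a+b≡)

stirling↔pairCode : (s : Fin n → ℕ) → IsComposition s →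
  Inverse (StirlingPermSetoid s) (PairCodeSetoid n s)
stirling↔pairCode s composition = inverse-restrict encode (decode s)
  (encode-pairCode s _) (decode-stirling s _) (decode-encode s _) (encode-decode s composition _)

-- Flows on G_s

pairSum : List ℕ → ℕ → ℕ
pairSum (a ∷ b ∷ _)  zero    = a + b
pairSum (_ ∷ _ ∷ ys) (suc j) = pairSum ys j
pairSum _            _       = 0

sumAbove : (Fin n → ℕ) → ℕ → ℕ
sumAbove {zero}  t _       = 0
sumAbove {suc n} t zero    = ∑ (tail t)
sumAbove {suc n} t (suc j) = sumAbove (tail t) j

sumAbove-last : ∀ k (t : Fin (suc k) → ℕ) → sumAbove t k ≡ 0
sumAbove-last zero    t = refl
sumAbove-last (suc k) t = sumAbove-last k (tail t)

sAt-tail : ∀ {m} i (t : Fin (suc m) → ℕ) → i < m → sAt t (2 + i) ≡ sAt (tail t) (suc i)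
sAt-tail {m} i t i<m rewrite dec-false (i ℕ.≟ m) (<⇒≢ i<m) = refl

sumAbove-step : ∀ {k} (t : Fin (suc k) → ℕ) j → j < k → sumAbove t j ≡ sAt t (2 + j) + sumAbove t (suc j)
sumAbove-step {suc k} t zero    _         = refl
sumAbove-step {suc k} t (suc j) (s≤s j<k) =
  trans (sumAbove-step (tail t) j j<k) (cong (_+ sumAbove t (2 + j)) (sym (sAt-tail (suc j) t (s≤s j<k))))

sum-sAt≡sumAbove : ∀ k (t : Fin (suc k) → ℕ) → sum (map (λ i → sAt t (i + 2)) (upTo k)) ≡ sumAbove t 0
sum-sAt≡sumAbove k t = trans (cong sum (map-applyUpTo id (λ i → sAt t (i + 2)) k))
  (suffix k 0 _ (λ i → cong (sAt t) (+-comm i 2)) (+-identityʳ k))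
  where
  suffix : ∀ r j (f : ℕ → ℕ) → (∀ i → f i ≡ sAt t (2 + (j + i))) → r + j ≡ k → sum (applyUpTo f r) ≡ sumAbove t j
  suffix zero    j f f≡ refl = sym (sumAbove-last j t)
  suffix (suc r) j f f≡ r+j≡k = begin
    f 0 + sum (applyUpTo (f ∘ suc) r)     ≡⟨ cong₂ _+_ (trans (f≡ 0) (cong (λ x → sAt t (2 + x)) (+-identityʳ j)))
                                                      (suffix r (suc j) (f ∘ suc) (λ i → trans (f≡ (suc i)) (cong (λ x → sAt t (2 + x)) (+-suc j i)))
                                                        (trans (+-suc r j) r+j≡k)) ⟩
    sAt t (2 + j) + sumAbove t (suc j)    ≡⟨ sym (sumAbove-step t j (subst (j <_) r+j≡k (m<n+m j (s≤s z≤n)))) ⟩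
    sumAbove t j                          ∎

-- v_{m-1} ⇉ v_m comes first, so the j-th pair of a flow on it sits on v_{m-1-j} ⇉ v_{m-j}.
pathEdges : ℕ → List Edge
pathEdges zero    = []
pathEdges (suc m) = (vtx m , vtx (suc m)) ∷ (vtx m , vtx (suc m)) ∷ pathEdges m

sourceEdges : (Fin n → ℕ) → List Edge
sourceEdges {n} s = concatMap (λ i → replicate (sAt s i ∸ 1) (vminus1 , vtx (n + 1 ∸ i))) (map suc (upTo (n + 1)))

edges≡source++path : (s : Fin n → ℕ) → edges s ≡ sourceEdges s ++ pathEdges n
edges≡source++path {n} s = cong (sourceEdges s ++_) (begin
  concat (map doubled (map suc (upTo n)))  ≡⟨ cong (concat ∘ map doubled) (map-applyUpTo id suc n) ⟩
  concat (map doubled (applyUpTo suc n))   ≡⟨ cong concat (map-applyUpTo suc doubled n) ⟩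
  concat (applyUpTo (doubled ∘ suc) n)     ≡⟨ path n ⟩
  pathEdges n                              ∎)
  where
  doubled : ℕ → List Edge
  doubled i = replicate 2 (vtx (n ∸ i) , vtx (n + 1 ∸ i))
  path : ∀ m → concat (applyUpTo (λ i → replicate 2 (vtx (m ∸ suc i) , vtx (m + 1 ∸ suc i))) m) ≡ pathEdges m
  path zero    = refl
  path (suc m) = cong₂ (λ e es → e ∷ e ∷ es) (cong (λ x → vtx m , vtx x) (+-comm m 1)) (path m)

IsSourceEdge : Edge → Set
IsSourceEdge e = ∃ λ t → e ≡ (vminus1 , vtx t)

all-sourceEdges : (s : Fin n → ℕ) → All IsSourceEdge (sourceEdges s)
all-sourceEdges {n} s = go (map suc (upTo (n + 1)))
  where
  go : ∀ is → All IsSourceEdge (concatMap (λ i → replicate (sAt s i ∸ 1) (vminus1 , vtx (n + 1 ∸ i))) is)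
  go []       = []
  go (i ∷ is) = ++⁺ (replicate⁺ (sAt s i ∸ 1) (_ , refl)) (go is)

inflow-++ : ∀ E E′ l v → inflow (E ++ E′) l v ≡ inflow E l v + inflow E′ (drop (length E) l) v
inflow-++ []              E′ l       v = refl
inflow-++ (_ ∷ E)         E′ []      v = sym (inflow-[] E′)
  where
  inflow-[] : ∀ E → inflow E [] v ≡ 0
  inflow-[] []      = refl
  inflow-[] (_ ∷ _) = refl
inflow-++ ((_ , t) ∷ E) E′ (x ∷ l) v =
  trans (cong (λ y → (if t ≡ᵇ v then x else 0) + y) (inflow-++ E E′ l v)) (sym (+-assoc (if t ≡ᵇ v then x else 0) _ _))

outflow-++ : ∀ E E′ l v → outflow (E ++ E′) l v ≡ outflow E l v + outflow E′ (drop (length E) l) v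
outflow-++ []              E′ l       v = refl
outflow-++ (_ ∷ E)         E′ []      v = sym (outflow-[] E′)
  where
  outflow-[] : ∀ E → outflow E [] v ≡ 0
  outflow-[] []      = refl
  outflow-[] (_ ∷ _) = refl
outflow-++ ((o , _) ∷ E) E′ (x ∷ l) v =
  trans (cong (λ y → (if o ≡ᵇ v then x else 0) + y) (outflow-++ E E′ l v)) (sym (+-assoc (if o ≡ᵇ v then x else 0) _ _))

inflow-zeros : ∀ E ys v → inflow E (replicate (length E) 0 ++ ys) v ≡ 0
inflow-zeros []              ys v = refl
inflow-zeros ((_ , t) ∷ E) ys v rewrite if-eta (t ≡ᵇ v) {0} = inflow-zeros E ys v

outflow-zeros : ∀ E ys v → outflow E (replicate (length E) 0 ++ ys) v ≡ 0
outflow-zeros []              ys v = refl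
outflow-zeros ((o , _) ∷ E) ys v rewrite if-eta (o ≡ᵇ v) {0} = outflow-zeros E ys v

inflow-source : ∀ {E} → All IsSourceEdge E → ∀ l → inflow E l vminus1 ≡ 0
inflow-source []              l       = refl
inflow-source ((_ , refl) ∷ _) []      = refl
inflow-source ((_ , refl) ∷ E) (_ ∷ l) = inflow-source E l

take-source-flow : ∀ {E} → All IsSourceEdge E → ∀ l → outflow E l vminus1 ≡ 0 → length E ≤ length l →
  take (length E) l ≡ replicate (length E) 0
take-source-flow []               l       _   _           = refl
take-source-flow ((_ , refl) ∷ E) (x ∷ l) out≡0 (s≤s E≤l) rewrite m+n≡0⇒m≡0 x out≡0 =
  cong (0 ∷_) (take-source-flow E l (m+n≡0⇒n≡0 x out≡0) E≤l)

inflow-path-below : ∀ m ys {c} → c < 2 → inflow (pathEdges m) ys c ≡ 0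
inflow-path-below zero    ys           _        = refl
inflow-path-below (suc m) []           _        = refl
inflow-path-below (suc m) (_ ∷ [])     (s≤s z≤n)       = refl
inflow-path-below (suc m) (_ ∷ [])     (s≤s (s≤s z≤n)) = refl
inflow-path-below (suc m) (_ ∷ _ ∷ ys) (s≤s z≤n)       = inflow-path-below m ys (s≤s z≤n)
inflow-path-below (suc m) (_ ∷ _ ∷ ys) (s≤s (s≤s z≤n)) = inflow-path-below m ys (s≤s (s≤s z≤n))

outflow-path-0 : ∀ m ys → outflow (pathEdges m) ys 0 ≡ 0
outflow-path-0 zero    ys           = refl
outflow-path-0 (suc m) []           = refl
outflow-path-0 (suc m) (_ ∷ [])     = refl
outflow-path-0 (suc m) (_ ∷ _ ∷ ys) = outflow-path-0 m ys

inflow-path-above : ∀ m ys c → suc m < c → inflow (pathEdges m) ys c ≡ 0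
inflow-path-above zero    ys           c _   = refl
inflow-path-above (suc m) []           c _   = refl
inflow-path-above (suc m) (_ ∷ [])     c m<c rewrite dec-false (2 + m ℕ.≟ c) (<⇒≢ m<c) = refl
inflow-path-above (suc m) (_ ∷ _ ∷ ys) c m<c rewrite dec-false (2 + m ℕ.≟ c) (<⇒≢ m<c) =
  inflow-path-above m ys c (<-trans (n<1+n (suc m)) m<c)

outflow-path-above : ∀ m ys c → m < c → outflow (pathEdges m) ys c ≡ 0
outflow-path-above zero    ys           c _   = refl
outflow-path-above (suc m) []           c _   = refl
outflow-path-above (suc m) (_ ∷ [])     c m<c rewrite dec-false (suc m ℕ.≟ c) (<⇒≢ m<c) = refl
outflow-path-above (suc m) (_ ∷ _ ∷ ys) c m<c rewrite dec-false (suc m ℕ.≟ c) (<⇒≢ m<c) =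
  outflow-path-above m ys c (<-trans (n<1+n m) m<c)

inflow-path : ∀ {m} i j ys → j + i ≡ m → length ys ≡ length (pathEdges (suc m)) →
  inflow (pathEdges (suc m)) ys (2 + i) ≡ pairSum ys j
inflow-path i zero    (a ∷ b ∷ ys) refl _
  rewrite dec-true (i ℕ.≟ i) refl | inflow-path-above i ys (2 + i) ≤-refl = cong (λ x → a + x) (+-identityʳ b)
inflow-path i (suc j) (a ∷ b ∷ ys) refl length-ys
  rewrite dec-false (suc (j + i) ℕ.≟ i) (m≢1+n+m i ∘ sym) = inflow-path i j ys refl (suc-injective (suc-injective length-ys))

outflow-path : ∀ {m} i j ys → j + i ≡ m → length ys ≡ length (pathEdges (suc m)) →
  outflow (pathEdges (suc m)) ys (1 + i) ≡ pairSum ys j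
outflow-path i zero    (a ∷ b ∷ ys) refl _
  rewrite dec-true (i ℕ.≟ i) refl | outflow-path-above i ys (1 + i) ≤-refl = cong (λ x → a + x) (+-identityʳ b)
outflow-path i (suc j) (a ∷ b ∷ ys) refl length-ys
  rewrite dec-false (suc (j + i) ℕ.≟ i) (m≢1+n+m i ∘ sym) = outflow-path i j ys refl (suc-injective (suc-injective length-ys))

dvec-interior : ∀ {k} (s : Fin (suc k) → ℕ) i j → suc j + i ≡ k → dvec s (2 + i) ≡ + sAt s (2 + j)
dvec-interior s i j refl rewrite dec-false (i ℕ.≟ suc j + i) (m≢1+n+m i) =
  cong (λ x → + sAt s x) (trans (cong (_∸ i) (rearrange i j)) (m+n∸m≡n i (2 + j)))
  where
  rearrange : ∀ i j → j + i + 2 ≡ i + (2 + j)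
  rearrange = solve-∀

dvec-sink : ∀ {k} (s : Fin (suc k) → ℕ) → dvec s (2 + k) ≡ - (+ sumAbove s 0)
dvec-sink {k} s rewrite dec-true (k ℕ.≟ k) refl = cong (λ x → - (+ x)) (sum-sAt≡sumAbove k s)

Conserved : (Fin n → ℕ) → List Edge → List ℕ → ℕ → Set
Conserved s E l c = + inflow E l c ℤ.+ dvec s c ≡ + outflow E l c

IsPathFlow : (Fin n → ℕ) → List ℕ → Set
IsPathFlow {n} s ys = ∀ c → c < 2 + n → Conserved s (pathEdges n) ys c

module _ {k : ℕ} (s : Fin (suc k) → ℕ) (ys : List ℕ) (length-ys : length ys ≡ length (pathEdges (suc k))) where

  conserved-source : Conserved s (pathEdges (suc k)) ys 0
  conserved-source rewrite inflow-path-below (suc k) ys (s≤s z≤n) | outflow-path-0 (suc k) ys = refl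

  conserved-start : Conserved s (pathEdges (suc k)) ys 1 ⇔ pairSum ys k ≡ 0
  conserved-start rewrite inflow-path-below (suc k) ys (s≤s (s≤s z≤n)) | outflow-path 0 k ys (+-identityʳ k) length-ys =
    mk⇔ (sym ∘ ℤ.+-injective) (cong (λ x → + x) ∘ sym)

  conserved-interior : ∀ i j → suc j + i ≡ k →
    Conserved s (pathEdges (suc k)) ys (2 + i) ⇔ (pairSum ys (suc j) + sAt s (2 + j) ≡ pairSum ys j)
  conserved-interior i j j+i≡k
    rewrite inflow-path i (suc j) ys j+i≡k length-ys
          | outflow-path (suc i) j ys (trans (+-suc j i) j+i≡k) length-ys
          | dvec-interior s i j j+i≡k = mk⇔ ℤ.+-injective (cong (λ x → + x))

  conserved-sink : Conserved s (pathEdges (suc k)) ys (2 + k) ⇔ pairSum ys 0 ≡ sumAbove s 0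
  conserved-sink
    rewrite inflow-path k 0 ys refl length-ys | outflow-path-above (suc k) ys (2 + k) ≤-refl | dvec-sink s =
    mk⇔ (ℤ.+-injective ∘ ℤ.i-j≡0⇒i≡j _ _) (ℤ.i≡j⇒i-j≡0 ∘ cong (λ x → + x))

  pathFlow⇒pairSum : IsPathFlow s ys → ∀ j → j ≤ k → pairSum ys j ≡ sumAbove s j
  pathFlow⇒pairSum flow j j≤k = downward (k ∸ j) j (m+[n∸m]≡n j≤k)
    where
    downward : ∀ d j → j + d ≡ k → pairSum ys j ≡ sumAbove s j
    downward zero    j j+0≡k rewrite +-identityʳ j | j+0≡k =
      trans (Equivalence.to conserved-start (flow 1 (s≤s (s≤s z≤n)))) (sym (sumAbove-last k s))
    downward (suc d) j j+d≡k = begin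
      pairSum ys j                            ≡⟨ sym (Equivalence.to (conserved-interior d j j+d≡k′) (flow (2 + d) bound)) ⟩
      pairSum ys (suc j) + sAt s (2 + j)      ≡⟨ cong (_+ sAt s (2 + j)) (downward d (suc j) (trans (sym (+-suc j d)) j+d≡k)) ⟩
      sumAbove s (suc j) + sAt s (2 + j)      ≡⟨ +-comm _ (sAt s (2 + j)) ⟩
      sAt s (2 + j) + sumAbove s (suc j)      ≡⟨ sym (sumAbove-step s j (subst (j <_) j+d≡k (m<m+n j (s≤s z≤n)))) ⟩
      sumAbove s j                            ∎
      where
      j+d≡k′ : suc j + d ≡ k
      j+d≡k′ = trans (sym (+-suc j d)) j+d≡k
      bound : 2 + d < 2 + suc k
      bound = s≤s (s≤s (s≤s (≤-trans (n≤1+n d) (subst (suc d ≤_) j+d≡k (m≤n+m (suc d) j)))))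

  pairSum⇒pathFlow : (∀ j → pairSum ys j ≡ sumAbove s j) → IsPathFlow s ys
  pairSum⇒pathFlow sums zero          _                     = conserved-source
  pairSum⇒pathFlow sums (suc zero)    _                     =
    Equivalence.from conserved-start (trans (sums k) (sumAbove-last k s))
  pairSum⇒pathFlow sums (suc (suc i)) (s≤s (s≤s (s≤s i≤k))) with m≤n⇒m<n∨m≡n i≤k
  ... | inj₂ refl = Equivalence.from conserved-sink (sums 0)
  ... | inj₁ i<k  = Equivalence.from (conserved-interior i j j+i≡k) (begin
      pairSum ys (suc j) + sAt s (2 + j)      ≡⟨ cong (_+ sAt s (2 + j)) (sums (suc j)) ⟩
      sumAbove s (suc j) + sAt s (2 + j)      ≡⟨ +-comm _ (sAt s (2 + j)) ⟩
      sAt s (2 + j) + sumAbove s (suc j)      ≡⟨ sym (sumAbove-step s j (subst (j <_) j+i≡k (s≤s (m≤m+n j i)))) ⟩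
      sumAbove s j                            ≡⟨ sym (sums j) ⟩
      pairSum ys j                            ∎)
    where
    j : ℕ
    j = k ∸ suc i
    j+i≡k : suc j + i ≡ k
    j+i≡k = trans (sym (+-suc j i)) (m∸n+n≡m i<k)

length-pairCode : {t : Fin m → ℕ} {ys : List ℕ} → PairCode m t ys → length ys ≡ length (pathEdges m)
length-pairCode []         = refl
length-pairCode (_ ∷ code) = cong (suc ∘ suc) (length-pairCode code)

pairSum-pairCode : {t : Fin m → ℕ} {ys : List ℕ} → PairCode m t ys → ∀ j → pairSum ys j ≡ sumAbove t j
pairSum-pairCode []           j       = refl
pairSum-pairCode (a+b≡ ∷ _)   zero    = a+b≡
pairSum-pairCode (_ ∷ code)   (suc j) = pairSum-pairCode code j

pairSum⇒pairCode : (t : Fin m → ℕ) (ys : List ℕ) → length ys ≡ length (pathEdges m) →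
  (∀ j → j < m → pairSum ys j ≡ sumAbove t j) → PairCode m t ys
pairSum⇒pairCode {zero}  t []           _         _    = []
pairSum⇒pairCode {suc m} t (a ∷ b ∷ ys) length-ys sums =
  sums 0 (s≤s z≤n) ∷ pairSum⇒pairCode (tail t) ys (suc-injective (suc-injective length-ys)) (λ j j<m → sums (suc j) (s≤s j<m))

drop-replicate-++ : ∀ r (ys : List ℕ) → drop r (replicate r 0 ++ ys) ≡ ys
drop-replicate-++ zero    ys = refl
drop-replicate-++ (suc r) ys = drop-replicate-++ r ys

-- Truncates or pads with zeros; only ever applied to lists of length N.
fitVec : (N : ℕ) → List ℕ → Vec ℕ N
fitVec zero    _       = Vec.[]
fitVec (suc N) []      = 0 Vec.∷ fitVec N []
fitVec (suc N) (x ∷ l) = x Vec.∷ fitVec N l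

toList-fitVec : ∀ N l → length l ≡ N → toList (fitVec N l) ≡ l
toList-fitVec zero    []      _        = refl
toList-fitVec (suc N) (x ∷ l) length-l = cong (x ∷_) (toList-fitVec N l (suc-injective length-l))

module _ {k : ℕ} (s : Fin (suc k) → ℕ) where

  private
    L : ℕ
    L = length (sourceEdges s)
    P : List Edge
    P = pathEdges (suc k)

  zeros : List ℕ
  zeros = replicate L 0

  numEdges≡source+path : numEdges s ≡ L + length P
  numEdges≡source+path = trans (cong length (edges≡source++path s)) (length-++ (sourceEdges s))

  inflow-padded : ∀ ys c → inflow (edges s) (zeros ++ ys) c ≡ inflow P ys c
  inflow-padded ys c = begin
    inflow (edges s) (zeros ++ ys) c                                    ≡⟨ cong (λ E → inflow E (zeros ++ ys) c) (edges≡source++path s) ⟩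
    inflow (sourceEdges s ++ P) (zeros ++ ys) c                         ≡⟨ inflow-++ (sourceEdges s) P (zeros ++ ys) c ⟩
    inflow (sourceEdges s) (zeros ++ ys) c + inflow P (drop L (zeros ++ ys)) c
      ≡⟨ cong₂ _+_ (inflow-zeros (sourceEdges s) ys c) (cong (λ l → inflow P l c) (drop-replicate-++ L ys)) ⟩
    inflow P ys c                                                       ∎

  outflow-padded : ∀ ys c → outflow (edges s) (zeros ++ ys) c ≡ outflow P ys c
  outflow-padded ys c = begin
    outflow (edges s) (zeros ++ ys) c                                   ≡⟨ cong (λ E → outflow E (zeros ++ ys) c) (edges≡source++path s) ⟩
    outflow (sourceEdges s ++ P) (zeros ++ ys) c                        ≡⟨ outflow-++ (sourceEdges s) P (zeros ++ ys) c ⟩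
    outflow (sourceEdges s) (zeros ++ ys) c + outflow P (drop L (zeros ++ ys)) c
      ≡⟨ cong₂ _+_ (outflow-zeros (sourceEdges s) ys c) (cong (λ l → outflow P l c) (drop-replicate-++ L ys)) ⟩
    outflow P ys c                                                      ∎

  conserved-padded : ∀ ys c → Conserved s (edges s) (zeros ++ ys) c ≡ Conserved s P ys c
  conserved-padded ys c = cong₂ (λ a b → + a ℤ.+ dvec s c ≡ + b) (inflow-padded ys c) (outflow-padded ys c)

  dFlow⇒conserved : (f : Vec ℕ (numEdges s)) → IsDFlow s f → ∀ c → c < 2 + suc k → Conserved s (edges s) (toList f) c
  dFlow⇒conserved f flow c c<2+n = subst (Conserved s (edges s) (toList f)) (toℕ-fromℕ< c<n+2) (flow (fromℕ< c<n+2))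
    where
    c<n+2 : c < suc k + 2
    c<n+2 = subst (c <_) (+-comm 2 (suc k)) c<2+n

  conserved⇒dFlow : (f : Vec ℕ (numEdges s)) → (∀ c → c < 2 + suc k → Conserved s (edges s) (toList f) c) → IsDFlow s f
  conserved⇒dFlow f conserved v = conserved (toℕ v) (subst (toℕ v <_) (+-comm (suc k) 2) (toℕ<n v))

  toFlow : List ℕ → Vec ℕ (numEdges s)
  toFlow ys = fitVec (numEdges s) (zeros ++ ys)

  fromFlow : Vec ℕ (numEdges s) → List ℕ
  fromFlow f = drop L (toList f)

  toList-dFlow : (f : Vec ℕ (numEdges s)) → IsDFlow s f → toList f ≡ zeros ++ fromFlow f
  toList-dFlow f flow = begin
    toList f                              ≡⟨ sym (take++drop≡id L (toList f)) ⟩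
    take L (toList f) ++ drop L (toList f) ≡⟨ cong (_++ drop L (toList f)) source-idle ⟩
    zeros ++ drop L (toList f)             ∎
    where
    l : List ℕ
    l = toList f
    at-source : + inflow (edges s) l 0 ℤ.+ + 0 ≡ + outflow (edges s) l 0
    at-source = flow Fin.zero
    in≡0 : inflow (edges s) l 0 ≡ 0
    in≡0 = trans (cong (λ E → inflow E l 0) (edges≡source++path s)) (trans (inflow-++ (sourceEdges s) P l 0)
      (cong₂ _+_ (inflow-source (all-sourceEdges s) l) (inflow-path-below (suc k) (drop L l) (s≤s z≤n))))
    out≡0 : outflow (sourceEdges s) l 0 ≡ 0
    out≡0 = begin
      outflow (sourceEdges s) l 0                                       ≡⟨ sym (+-identityʳ _) ⟩
      outflow (sourceEdges s) l 0 + 0                                   ≡⟨ cong (λ x → outflow (sourceEdges s) l 0 + x) (sym (outflow-path-0 (suc k) (drop L l))) ⟩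
      outflow (sourceEdges s) l 0 + outflow P (drop L l) 0              ≡⟨ sym (outflow-++ (sourceEdges s) P l 0) ⟩
      outflow (sourceEdges s ++ P) l 0                                  ≡⟨ cong (λ E → outflow E l 0) (sym (edges≡source++path s)) ⟩
      outflow (edges s) l 0                                             ≡⟨ sym (ℤ.+-injective at-source) ⟩
      inflow (edges s) l 0 + 0                                          ≡⟨ cong (_+ 0) in≡0 ⟩
      0                                                                 ∎
    source-idle : take L l ≡ zeros
    source-idle = take-source-flow (all-sourceEdges s) l out≡0
      (subst (L ≤_) (sym (trans (length-toList f) numEdges≡source+path)) (m≤m+n L (length P)))

  toList-toFlow : ∀ {ys} → PairCode (suc k) s ys → toList (toFlow ys) ≡ zeros ++ ys
  toList-toFlow {ys} code = toList-fitVec (numEdges s) (zeros ++ ys)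
    (trans (length-++ zeros) (trans (cong₂ _+_ (length-replicate L) (length-pairCode code)) (sym numEdges≡source+path)))

  toFlow-dFlow : ∀ {ys} → PairCode (suc k) s ys → IsDFlow s (toFlow ys)
  toFlow-dFlow {ys} code = conserved⇒dFlow (toFlow ys) λ c c< →
    subst (λ l → Conserved s (edges s) l c) (sym (toList-toFlow code))
      (subst id (sym (conserved-padded ys c)) (pairSum⇒pathFlow s ys (length-pairCode code) (pairSum-pairCode code) c c<))

  fromFlow-pairCode : ∀ {f} → IsDFlow s f → PairCode (suc k) s (fromFlow f)
  fromFlow-pairCode {f} flow = pairSum⇒pairCode s ys length-ys
    (λ j j<n → pathFlow⇒pairSum s ys length-ys pathFlow j (≤-pred j<n))
    where
    ys : List ℕ
    ys = fromFlow f
    length-ys : length ys ≡ length P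
    length-ys = trans (length-drop L (toList f)) (trans (cong (_∸ L) (trans (length-toList f) numEdges≡source+path)) (m+n∸m≡n L (length P)))
    pathFlow : IsPathFlow s ys
    pathFlow c c< = subst id (conserved-padded ys c)
      (subst (λ l → Conserved s (edges s) l c) (toList-dFlow f flow) (dFlow⇒conserved f flow c c<))

  fromFlow-toFlow : ∀ {ys} → PairCode (suc k) s ys → fromFlow (toFlow ys) ≡ ys
  fromFlow-toFlow {ys} code = trans (cong (drop L) (toList-toFlow code)) (drop-replicate-++ L ys)

  toFlow-fromFlow : ∀ {f} → IsDFlow s f → toFlow (fromFlow f) ≡ f
  toFlow-fromFlow {f} flow = trans (sym (cast-is-id refl (toFlow (fromFlow f))))
    (toList-injective refl _ f (trans (toList-toFlow (fromFlow-pairCode flow)) (sym (toList-dFlow f flow))))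

  pairCode↔dFlow : Inverse (PairCodeSetoid (suc k) s) (DFlowSetoid s)
  pairCode↔dFlow = inverse-restrict toFlow fromFlow toFlow-dFlow fromFlow-pairCode fromFlow-toFlow toFlow-fromFlow

proposition3p6 : (n : ℕ) → 1 ≤ n → (s : Fin n → ℕ) → IsComposition s →
    Bijection (StirlingPermSetoid s) (DFlowSetoid s)
proposition3p6 (suc k) _ s composition =
  Inverse⇒Bijection (Compose.inverse (stirling↔pairCode s composition) (pairCode↔dFlow s))
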